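{- Let $k\in\mathbb N$. For every $S\subseteq R^k_{\{0,1\}}$ we have $\langle S\rangle_{\mathrm{qpp}}=\mathrm{EO}_6(S)=\mathrm{EO}_\wedge(\mathrm{EO}_5(S))$.
   Context: $E_k=\{1,\dots,k\}$. $R^k_{\{0,1\}}$ is the set of $k$-sorted relations on $\{0,1\}$: subsets of $\{0,1\}^n$ ($n\ge0$, viewed as predicates) with each variable assigned a sort in $E_k$. $\sigma_\bot$ is the empty $0$-ary relation and $\sigma^i_=$ equality on sort $i$. $\langle S\rangle_{\mathrm{qpp}}$ is the set of relations definable by formulas built from predicates in $S\cup\{\sigma_\bot,\sigma_=^1,\dots,\sigma_=^k\}$ using conjunction, existential and universal quantification only, each variable having one sort and substituted only into positions of that sort. A variable is dummy if the predicate does not depend on it. Elementary operations: (eo1) appending or removing a dummy variable; (eo2) permuting variables; (eo3) identifying the first two variables when they have the same sort; (eo4) composition: for $\rho_1,\rho_2$ whose first variables are non-dummy and of the same sort, $\rho'(x_1,\dots,x_{n-1},y_1,\dots,y_{m-1})=\exists z\,\rho_1(z,x_1,\dots,x_{n-1})\land\rho_2(z,y_1,\dots,y_{m-1})$; (eo5) $\rho'(x_1,\dots,x_{n-1})=\forall y\,\rho(y,x_1,\dots,x_{n-1})$; (eo6) conjunction of two $n$-ary relations whose $i$-th variables have the same sort for each $i$. $\mathrm{EO}_i(S)$ is the set of relations obtainable from elements of $S\cup\{\sigma_\bot,\sigma_=^1,\dots,\sigma_=^k\}$ by sequences of operations (eo1)–(eo$i$), and $\mathrm{EO}_\wedge(T)$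 is the set of relations obtainable from elements of $T$ by sequences of operations (eo6). -}

module Defs where

open import Data.Nat using (ℕ; zero; suc; _+_)
open import Data.Fin using (Fin; zero; suc)
open import Data.Bool using (Bool; true; false; _∧_; _∨_; not)
open import Data.Vec using (Vec; []; _∷_; lookup; tabulate; insertAt; removeAt; _[_]≔_; _++_; take; drop; init; _∷ʳ_)
open import Data.Fin.Permutation using (Permutation′; _⟨$⟩ʳ_; _⟨$⟩ˡ_)
open import Data.Product using (Σ; _×_; _,_)
open import Function.Bundles using (_⇔_)
open import Relation.Binary.PropositionalEquality using (_≡_)
open import Relation.Nullary using (¬_)

-- A set of k-sorted relations on {0,1}: a k-sorted relation is given by its
-- arity n, its sort vector σ (sorts in E_k represented by Fin k), and its
-- characteristic function on {0,1}^n (0 = false, 1 = true).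
Rels : ℕ → Set₁
Rels k = (n : ℕ) → Vec (Fin k) n → (Vec Bool n → Bool) → Set

Has : ∀ {k} → Rels k → Rels k
Has X n σ p = Σ (Vec Bool n → Bool) (λ q → X n σ q × (∀ v → q v ≡ p v))

_≐_ : ∀ {k} → Rels k → Rels k → Set
X ≐ Y = ∀ n σ p → Has X n σ p ⇔ Has Y n σ p

_==_ : Bool → Bool → Bool
true == b = b
false == b = not b

botPred : Vec Bool 0 → Bool
botPred _ = false

eqPred : Vec Bool 2 → Bool
eqPred (x ∷ y ∷ []) = x == y

Dummy : ∀ {n} → (Vec Bool n → Bool) → Fin n → Set
Dummy p i = ∀ v b → p (v [ i ]≔ b) ≡ p v

data Base {k} (S : Rels k) : Rels k where
  inS : ∀ {n σ p} → S n σ p → Base S n σ p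
  bot : Base S 0 [] botPred
  eq  : (i : Fin k) → Base S 2 (i ∷ i ∷ []) eqPred

permute : ∀ {A : Set} {n} → Permutation′ n → Vec A n → Vec A n
permute π v = tabulate (λ i → lookup v (π ⟨$⟩ʳ i))

permuteInv : ∀ {A : Set} {n} → Permutation′ n → Vec A n → Vec A n
permuteInv π v = tabulate (λ i → lookup v (π ⟨$⟩ˡ i))

appendPred : ∀ {n} → (Vec Bool n → Bool) → Vec Bool (suc n) → Bool
appendPred p v = p (init v)

removePred : ∀ {n} → (Vec Bool (suc n) → Bool) → Fin (suc n) → Vec Bool n → Bool
removePred p i v = p (insertAt v i false)

permPred : ∀ {n} → Permutation′ n → (Vec Bool n → Bool) → Vec Bool n → Bool
permPred π p w = p (permuteInv π w)

identPred : ∀ {n} → (Vec Bool (suc (suc n)) → Bool) → Vec Bool (suc n) → Bool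
identPred p (x ∷ v) = p (x ∷ x ∷ v)

compPred : ∀ {n m} → (Vec Bool (suc n) → Bool) → (Vec Bool (suc m) → Bool)
           → Vec Bool (n + m) → Bool
compPred {n} p₁ p₂ v =
  (p₁ (false ∷ take n v) ∧ p₂ (false ∷ drop n v)) ∨
  (p₁ (true ∷ take n v) ∧ p₂ (true ∷ drop n v))

univPred : ∀ {n} → (Vec Bool (suc n) → Bool) → Vec Bool n → Bool
univPred p v = p (false ∷ v) ∧ p (true ∷ v)

conjPred : ∀ {n} → (Vec Bool n → Bool) → (Vec Bool n → Bool) → Vec Bool n → Bool
conjPred p q v = p v ∧ q v

-- EO-closure. With c = false: operations (eo1)–(eo5), i.e. EO₅(S);
-- with c = true: operations (eo1)–(eo6), i.e. EO₆(S).
data EO {k} (c : Bool) (S : Rels k) : Rels k where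
  base     : ∀ {n σ p} → Base S n σ p → EO c S n σ p
  append   : ∀ {n σ p} (s : Fin k) → EO c S n σ p → EO c S (suc n) (σ ∷ʳ s) (appendPred p)
  remove   : ∀ {n σ p} (i : Fin (suc n)) → Dummy p i → EO c S (suc n) σ p
             → EO c S n (removeAt σ i) (removePred p i)
  -- (eo2) permuting variables: ρ'(x) = ρ(x_{π⁻¹(1)},…); sorts permuted accordingly
  perm     : ∀ {n σ p} (π : Permutation′ n) → EO c S n σ p
             → EO c S n (permute π σ) (permPred π p)
  ident    : ∀ {n s σ p} → EO c S (suc (suc n)) (s ∷ s ∷ σ) p
             → EO c S (suc n) (s ∷ σ) (identPred p)
  comp     : ∀ {n m s σ₁ σ₂ p₁ p₂} → ¬ Dummy p₁ zero → ¬ Dummy p₂ zero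
             → EO c S (suc n) (s ∷ σ₁) p₁ → EO c S (suc m) (s ∷ σ₂) p₂
             → EO c S (n + m) (σ₁ ++ σ₂) (compPred p₁ p₂)
  univ     : ∀ {n s σ p} → EO c S (suc n) (s ∷ σ) p → EO c S n σ (univPred p)
  conj     : ∀ {n σ p q} → c ≡ true → EO c S n σ p → EO c S n σ q
             → EO c S n σ (conjPred p q)

EO₅ EO₆ : ∀ {k} → Rels k → Rels k
EO₅ = EO false
EO₆ = EO true

data EO∧ {k} (T : Rels k) : Rels k where
  base : ∀ {n σ p} → T n σ p → EO∧ T n σ p
  conj : ∀ {n σ p q} → EO∧ T n σ p → EO∧ T n σ q → EO∧ T n σ (conjPred p q)

data Formula {k} (S : Rels k) : ∀ {m} → Vec (Fin k) m → Set where
  atom : ∀ {m} {Γ : Vec (Fin k) m} {n σ p} → Base S n σ p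
         → (f : Fin n → Fin m) → (∀ j → lookup Γ (f j) ≡ lookup σ j)
         → Formula S Γ
  and  : ∀ {m} {Γ : Vec (Fin k) m} → Formula S Γ → Formula S Γ → Formula S Γ
  ex   : ∀ {m} {Γ : Vec (Fin k) m} (s : Fin k) → Formula S (s ∷ Γ) → Formula S Γ
  all  : ∀ {m} {Γ : Vec (Fin k) m} (s : Fin k) → Formula S (s ∷ Γ) → Formula S Γ

⟦_⟧ : ∀ {k} {S : Rels k} {m} {Γ : Vec (Fin k) m} → Formula S Γ → Vec Bool m → Bool
⟦ atom {p = p} _ f _ ⟧ v = p (tabulate (λ j → lookup v (f j)))
⟦ and φ ψ ⟧ v = ⟦ φ ⟧ v ∧ ⟦ ψ ⟧ v
⟦ ex s φ ⟧ v = ⟦ φ ⟧ (false ∷ v) ∨ ⟦ φ ⟧ (true ∷ v)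
⟦ all s φ ⟧ v = ⟦ φ ⟧ (false ∷ v) ∧ ⟦ φ ⟧ (true ∷ v)

Qpp : ∀ {k} → Rels k → Rels k
Qpp S n σ p = Σ (Formula S σ) (λ φ → ∀ v → ⟦ φ ⟧ v ≡ p v)

-- EO₆(S) ⊆ ⟨S⟩_qpp because every elementary operation is a qpp-formula: a renaming of
-- variables, with ∃ for composition and ∀ for removing a dummy variable.
-- Conversely, every qpp-formula defines a conjunction of relations in EO₅(S), by induction
-- on the formula.  Atoms are minors of base relations, and EO₅(S) is closed under minors.
-- ∃x ρ for one relation ρ is the composition of ρ with itself restricted to the diagonal
-- (or ∀x ρ when x is a dummy variable, where (eo4) does not apply).  ∃x of a conjunction
-- ρ₁ ∧ … ∧ ρₗ reduces to this case because subsets of {0,1} have Helly number 2: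
-- ∃x ⋀ᵢ ρᵢ = ⋀ᵢⱼ ∃x (ρᵢ ∧ ρⱼ).
{-# OPTIONS --safe #-}
module Submission where

open import Defs
open import Algebra.Bundles using (CommutativeMonoid)
open import Data.Bool using (Bool; true; false; T; _∧_; _∨_)
open import Data.Bool.Properties
  using (∧-idem; ∨-idem; ∧-distribˡ-∨; ∧-distribʳ-∨; T-∧; T-∨; ∧-commutativeMonoid) renaming (_≟_ to _≟ᵇ_)
open import Algebra.Properties.CommutativeSemigroup (CommutativeMonoid.commutativeSemigroup ∧-commutativeMonoid)
  using () renaming (interchange to ∧-interchange)
open import Data.Empty using (⊥-elim)
open import Data.Fin using (Fin; zero; suc; inject₁; lift; pinch; _↑ˡ_; _↑ʳ_)
open import Data.Fin.Permutation using (Permutation′; _⟨$⟩ʳ_; _⟨$⟩ˡ_; inverseʳ; permutation; transpose; _∘ₚ_)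
open import Data.Fin.Properties using (any?; cantor-schröder-bernstein) renaming (_≟_ to _≟ᶠ_)
open import Data.Nat using (ℕ; zero; suc; _+_)
open import Data.Product using (Σ; ∃; _×_; _,_)
open import Data.Sum using (_⊎_; inj₁; inj₂; [_,_])
open import Data.Vec
  using (Vec; []; _∷_; lookup; tabulate; allFin; map; insertAt; removeAt; _[_]≔_; _++_; take; drop; init; _∷ʳ_)
open import Data.Vec.Properties
  using ( lookup∘tabulate; tabulate∘lookup; tabulate-cong; tabulate-∘; lookup-map; map-insertAt; insertAt-removeAt
        ; lookup-++ˡ; lookup-++ʳ; map-∷ʳ; init-∷ʳ; map-lookup-allFin; map-++; ++-injective; take++drop≡id)
open import Data.Vec.Membership.Propositional using (_∈_)
open import Data.Vec.Membership.Propositional.Properties using (∈-tabulate⁺; ∈-allFin⁺)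
open import Data.Vec.Relation.Unary.Any using (here; there; index)
open import Data.Vec.Relation.Unary.Any.Properties using (lookup-index)
open import Function using (_∘_; id)
open import Function.Bundles using (_⇔_; mk⇔; Equivalence)
open import Function.Definitions using (Injective)
open import Relation.Binary.PropositionalEquality using (_≡_; _≢_; refl; sym; trans; cong; cong₂; subst; _≗_)
open import Relation.Nullary using (¬_; Dec; yes; no; contradiction)
open import Relation.Nullary.Decidable using (¬?; _×-dec_; map′)

open Equivalence using (to; from)

variable
  A : Set
  n m : ℕ

Predicate : ℕ → Set
Predicate n = Vec Bool n → Bool

reindex : (Fin n → Fin m) → Vec A m → Vec A n
reindex f v = tabulate (lookup v ∘ f)

reindex-∘ : ∀ (f : Fin n → Fin m) {l} (g : Fin m → Fin l) (v : Vec A l) →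
            reindex f (reindex g v) ≡ reindex (g ∘ f) v
reindex-∘ f g v = tabulate-cong (lookup∘tabulate (lookup v ∘ g) ∘ f)

reindex-lookup : ∀ (xs : Vec (Fin m) n) (v : Vec A m) → reindex (lookup xs) v ≡ map (lookup v) xs
reindex-lookup xs v = trans (tabulate-∘ (lookup v) (lookup xs)) (cong (map (lookup v)) (tabulate∘lookup xs))

reindex-inject₁ : ∀ (v : Vec A (suc n)) → reindex inject₁ v ≡ init v
reindex-inject₁ {n = zero}  (x ∷ []) = refl
reindex-inject₁ {n = suc n} (x ∷ v)  = cong (x ∷_) (reindex-inject₁ v)

reindex-↑ˡ : ∀ n (w : Vec A (n + m)) → reindex (_↑ˡ m) w ≡ take n w
reindex-↑ˡ zero    w       = refl
reindex-↑ˡ (suc n) (x ∷ w) = cong (x ∷_) (reindex-↑ˡ n w)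

reindex-↑ʳ : ∀ n (w : Vec A (n + m)) → reindex (n ↑ʳ_) w ≡ drop n w
reindex-↑ʳ zero    w       = tabulate∘lookup w
reindex-↑ʳ (suc n) (x ∷ w) = reindex-↑ʳ n w

lookup-∷ʳ-inject₁ : ∀ (xs : Vec A n) y i → lookup (xs ∷ʳ y) (inject₁ i) ≡ lookup xs i
lookup-∷ʳ-inject₁ (x ∷ xs) y zero    = refl
lookup-∷ʳ-inject₁ (x ∷ xs) y (suc i) = lookup-∷ʳ-inject₁ xs y i

-- The positions in (x ∷ xs) of the entries of insertAt xs i x.
insertionIndices : Fin (suc n) → Vec (Fin (suc n)) (suc n)
insertionIndices i = insertAt (tabulate suc) i zero

map-lookup-insertionIndices : ∀ (x : A) (xs : Vec A n) i →
                              map (lookup (x ∷ xs)) (insertionIndices i) ≡ insertAt xs i x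
map-lookup-insertionIndices x xs i =
  trans (map-insertAt (lookup (x ∷ xs)) zero (tabulate suc) i)
        (cong (λ ys → insertAt ys i x) (trans (sym (tabulate-∘ (lookup (x ∷ xs)) suc)) (tabulate∘lookup xs)))

insertAt-≔ : ∀ (xs : Vec A n) i (x y : A) → insertAt xs i x [ i ]≔ y ≡ insertAt xs i y
insertAt-≔ xs       zero    x y = refl
insertAt-≔ (z ∷ xs) (suc i) x y = cong (z ∷_) (insertAt-≔ xs i x y)

lookup-permute-inverse : ∀ (π : Permutation′ n) (xs : Vec A n) i → lookup (permute π xs) (π ⟨$⟩ˡ i) ≡ lookup xs i
lookup-permute-inverse π xs i = trans (lookup∘tabulate _ (π ⟨$⟩ˡ i)) (cong (lookup xs) (inverseʳ π))

map-permute : ∀ {B : Set} (f : A → B) (π : Permutation′ n) (xs : Vec A n) →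
              map f (permute π xs) ≡ permute π (map f xs)
map-permute f π xs = trans (sym (tabulate-∘ f _)) (tabulate-cong (λ i → sym (lookup-map (π ⟨$⟩ʳ i) f xs)))

permuteInv-permute : ∀ (π : Permutation′ n) (xs : Vec A n) → permuteInv π (permute π xs) ≡ xs
permuteInv-permute π xs = trans (tabulate-cong (lookup-permute-inverse π xs)) (tabulate∘lookup xs)

∈-permute : ∀ (π : Permutation′ n) {x} {xs : Vec A n} → x ∈ xs → x ∈ permute π xs
∈-permute π {xs = xs} x∈xs =
  subst (_∈ permute π xs) (trans (cong (lookup xs) (inverseʳ π)) (sym (lookup-index x∈xs)))
        (∈-tabulate⁺ (lookup xs ∘ (π ⟨$⟩ʳ_)) (π ⟨$⟩ˡ index x∈xs))

∈-∷ʳ⁺ˡ : ∀ {x y} {xs : Vec A n} → x ∈ xs → x ∈ xs ∷ʳ y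
∈-∷ʳ⁺ˡ (here x≡z)   = here x≡z
∈-∷ʳ⁺ˡ (there x∈xs) = there (∈-∷ʳ⁺ˡ x∈xs)

∈-∷ʳ⁺ʳ : ∀ {y} (xs : Vec A n) → y ∈ xs ∷ʳ y
∈-∷ʳ⁺ʳ []       = here refl
∈-∷ʳ⁺ʳ (x ∷ xs) = there (∈-∷ʳ⁺ʳ xs)

pairToFront : ∀ (i j : Fin (suc (suc n))) → i ≢ j →
              Σ (Permutation′ (suc (suc n))) λ π → π ⟨$⟩ʳ zero ≡ i × π ⟨$⟩ʳ suc zero ≡ j
pairToFront i j i≢j with transpose zero i ⟨$⟩ˡ j in τj≡
... | zero   = contradiction (trans (cong (transpose zero i ⟨$⟩ʳ_) (sym τj≡)) (inverseʳ (transpose zero i))) i≢j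
... | suc j′ = transpose (suc zero) (suc j′) ∘ₚ transpose zero i , refl ,
               trans (cong (transpose zero i ⟨$⟩ʳ_) (sym τj≡)) (inverseʳ (transpose zero i))

module _ {xs : Vec (Fin m) n} (covers : ∀ a → a ∈ xs) where

  position : Fin m → Fin n
  position a = index (covers a)

  lookup-position : ∀ a → lookup xs (position a) ≡ a
  lookup-position a = sym (lookup-index (covers a))

  covering-injective⇒length : Injective _≡_ _≡_ (lookup xs) → n ≡ m
  covering-injective⇒length injective = cantor-schröder-bernstein injective
    (λ {a} {b} same → trans (sym (lookup-position a)) (trans (cong (lookup xs) same) (lookup-position b)))

sortingPermutation : ∀ (xs : Vec (Fin n) n) (covers : ∀ a → a ∈ xs) → Injective _≡_ _≡_ (lookup xs) →
                     Σ (Permutation′ n) λ π → permute π xs ≡ allFin n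
sortingPermutation xs covers injective =
  permutation (position covers) (lookup xs) (λ i → injective (lookup-position covers (lookup xs i)))
              (lookup-position covers) ,
  tabulate-cong (lookup-position covers)

Duplicate : Vec A n → Set
Duplicate xs = ∃ λ i → ∃ λ j → i ≢ j × lookup xs i ≡ lookup xs j

duplicate? : (xs : Vec (Fin m) n) → Dec (Duplicate xs)
duplicate? xs = any? λ i → any? λ j → ¬? (i ≟ᶠ j) ×-dec (lookup xs i ≟ᶠ lookup xs j)

distinct⇒injective : ∀ {xs : Vec A n} → ¬ Duplicate xs → Injective _≡_ _≡_ (lookup xs)
distinct⇒injective distinct {i} {j} same with i ≟ᶠ j
... | yes i≡j = i≡j
... | no  i≢j = contradiction (i , j , i≢j , same) distinct

HeadIrrelevant : Predicate (suc n) → Set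
HeadIrrelevant p = ∀ v → p (false ∷ v) ≡ p (true ∷ v)

∀-Vec-Bool? : ∀ {n} {P : Vec Bool n → Set} → (∀ v → Dec (P v)) → Dec (∀ v → P v)
∀-Vec-Bool? {zero}  P? = map′ (λ p → λ { [] → p }) (λ every → every []) (P? [])
∀-Vec-Bool? {suc n} P? =
  map′ (λ (f , t) → λ { (false ∷ v) → f v ; (true ∷ v) → t v }) (λ every → every ∘ (false ∷_) , every ∘ (true ∷_))
       (∀-Vec-Bool? (P? ∘ (false ∷_)) ×-dec ∀-Vec-Bool? (P? ∘ (true ∷_)))

headIrrelevant? : (p : Predicate (suc n)) → Dec (HeadIrrelevant p)
headIrrelevant? p = ∀-Vec-Bool? λ v → p (false ∷ v) ≟ᵇ p (true ∷ v)

exPred : Predicate (suc n) → Predicate n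
exPred p v = p (false ∷ v) ∨ p (true ∷ v)

univPred≗exPred : ∀ {p : Predicate (suc n)} → HeadIrrelevant p → univPred p ≗ exPred p
univPred≗exPred {p = p} irrelevant v rewrite irrelevant v =
  trans (∧-idem (p (true ∷ v))) (sym (∨-idem (p (true ∷ v))))

compPred-diagonal : ∀ (p q : Predicate (suc n)) v → compPred p q (v ++ v) ≡ exPred (conjPred p q) v
compPred-diagonal {n} p q v with take≡ , drop≡ ← ++-injective (take n (v ++ v)) v (take++drop≡id n (v ++ v)) =
  cong₂ (λ u w → (p (false ∷ u) ∧ q (false ∷ w)) ∨ (p (true ∷ u) ∧ q (true ∷ w))) take≡ drop≡

exPred-conj-irrelevantˡ : ∀ {p q : Predicate (suc n)} → HeadIrrelevant p →
                          conjPred (univPred p) (exPred q) ≗ exPred (conjPred p q)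
exPred-conj-irrelevantˡ {p = p} {q} irrelevant v rewrite irrelevant v =
  trans (cong (_∧ _) (∧-idem (p (true ∷ v)))) (∧-distribˡ-∨ (p (true ∷ v)) (q (false ∷ v)) (q (true ∷ v)))

exPred-conj-irrelevantʳ : ∀ {p q : Predicate (suc n)} → HeadIrrelevant q →
                          conjPred (exPred p) (univPred q) ≗ exPred (conjPred p q)
exPred-conj-irrelevantʳ {p = p} {q} irrelevant v rewrite irrelevant v =
  trans (cong (exPred p v ∧_) (∧-idem (q (true ∷ v)))) (∧-distribʳ-∨ (q (true ∷ v)) (p (false ∷ v)) (p (true ∷ v)))

univPred-conj : ∀ (p q : Predicate (suc n)) → conjPred (univPred p) (univPred q) ≗ univPred (conjPred p q)
univPred-conj p q v = ∧-interchange (p (false ∷ v)) (p (true ∷ v)) (q (false ∷ v)) (q (true ∷ v))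

Meets : (Bool → Bool) → (Bool → Bool) → Set
Meets a b = ∃ λ x → T (a x) × T (b x)

Bool-pigeonhole : ∀ (x y z : Bool) → x ≡ y ⊎ x ≡ z ⊎ y ≡ z
Bool-pigeonhole false false _     = inj₁ refl
Bool-pigeonhole true  true  _     = inj₁ refl
Bool-pigeonhole false true  false = inj₂ (inj₁ refl)
Bool-pigeonhole true  false true  = inj₂ (inj₁ refl)
Bool-pigeonhole false true  true  = inj₂ (inj₂ refl)
Bool-pigeonhole true  false false = inj₂ (inj₂ refl)

helly : ∀ {a b c : Bool → Bool} → Meets a b → Meets a c → Meets b c → ∃ λ x → T (a x) × T (b x) × T (c x)
helly (x , ax , bx) (y , ay , cy) (z , bz , cz) with Bool-pigeonhole x y z
... | inj₁ refl        = x , ax , bx , cy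
... | inj₂ (inj₁ refl) = x , ax , bx , cz
... | inj₂ (inj₂ refl) = y , ay , bz , cy

T-ext : ∀ {x y} → (T x → T y) → (T y → T x) → x ≡ y
T-ext {false} {false} _ _ = refl
T-ext {false} {true}  _ g = ⊥-elim (g _)
T-ext {true}  {false} f _ = ⊥-elim (f _)
T-ext {true}  {true}  _ _ = refl

T-∃ : ∀ {a : Bool → Bool} → T (a false ∨ a true) ⇔ ∃ (T ∘ a)
T-∃ {a} = mk⇔ (λ t → [ (false ,_) , (true ,_) ] (to (T-∨ {a false}) t))
              (λ { (false , t) → from (T-∨ {a false}) (inj₁ t) ; (true , t) → from (T-∨ {a false}) (inj₂ t) })

T-exPred-conj : ∀ (p q : Predicate (suc n)) v → T (exPred (conjPred p q) v) ⇔ Meets (p ∘ (_∷ v)) (q ∘ (_∷ v))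
T-exPred-conj p q v =
  mk⇔ (λ t → let x , pqx = to (T-∃ {conjPred p q ∘ (_∷ v)}) t in x , to T-∧ pqx)
      (λ (x , px , qx) → from (T-∃ {conjPred p q ∘ (_∷ v)}) (x , from T-∧ (px , qx)))

record Decides (p q : Predicate (suc n)) (r : Predicate n) : Set where
  field
    meets⇒r : ∀ {v} → Meets (p ∘ (_∷ v)) (q ∘ (_∷ v)) → T (r v)
    r⇒meets : ∀ {v} → ∃ (T ∘ p ∘ (_∷ v)) → ∃ (T ∘ q ∘ (_∷ v)) → T (r v) → Meets (p ∘ (_∷ v)) (q ∘ (_∷ v))

open Decides

decides-pair : ∀ {p q : Predicate (suc n)} → Decides p q (exPred (conjPred p q))
decides-pair {p = p} {q} .meets⇒r {v}     = from (T-exPred-conj p q v)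
decides-pair {p = p} {q} .r⇒meets {v} _ _ = to (T-exPred-conj p q v)

decides-sym : ∀ {p q : Predicate (suc n)} {r} → Decides p q r → Decides q p r
decides-sym d .meets⇒r (x , qx , px) = meets⇒r d (x , px , qx)
decides-sym d .r⇒meets ∃q ∃p rv     = let x , px , qx = r⇒meets d ∃p ∃q rv in x , qx , px

decides-conjˡ : ∀ {p p′ q : Predicate (suc n)} {r r′} → Decides p q r → Decides p′ q r′ →
                Decides (conjPred p p′) q (conjPred r r′)
decides-conjˡ d d′ .meets⇒r (x , pp′x , qx) =
  let px , p′x = to T-∧ pp′x in from T-∧ (meets⇒r d (x , px , qx) , meets⇒r d′ (x , p′x , qx))
decides-conjˡ d d′ .r⇒meets (x , pp′x) ∃q rr′v =
  let px , p′x = to T-∧ pp′x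
      rv , r′v = to T-∧ rr′v
      w , pw , p′w , qw = helly (x , px , p′x) (r⇒meets d (x , px) ∃q rv) (r⇒meets d′ (x , p′x) ∃q r′v)
  in w , from T-∧ (pw , p′w) , qw

decides-conjʳ : ∀ {p q q′ : Predicate (suc n)} {r r′} → Decides p q r → Decides p q′ r′ →
                Decides p (conjPred q q′) (conjPred r r′)
decides-conjʳ d d′ = decides-sym (decides-conjˡ (decides-sym d) (decides-sym d′))

exPred-conj : ∀ {p q : Predicate (suc n)} {r} → Decides p q r →
              conjPred (conjPred (exPred p) (exPred q)) r ≗ exPred (conjPred p q)
exPred-conj {p = p} {q} d v = T-ext
  (λ t → let ∃p∃q , rv = to T-∧ t
             ∃p , ∃q   = to T-∧ ∃p∃q
         in from (T-exPred-conj p q v) (r⇒meets d (to (T-∃ {p ∘ (_∷ v)}) ∃p) (to (T-∃ {q ∘ (_∷ v)}) ∃q) rv))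
  (λ t → let x , px , qx = to (T-exPred-conj p q v) t
         in from T-∧ (from T-∧ (from (T-∃ {p ∘ (_∷ v)}) (x , px) , from (T-∃ {q ∘ (_∷ v)}) (x , qx)) ,
                      meets⇒r d (x , px , qx)))

module Soundness {k} (S : Rels k) where

  lift-sorts : ∀ {m m′} {Γ : Vec (Fin k) m} {Γ′ : Vec (Fin k) m′} {g : Fin m → Fin m′} s →
               (∀ j → lookup Γ′ (g j) ≡ lookup Γ j) → ∀ j → lookup (s ∷ Γ′) (lift 1 g j) ≡ lookup (s ∷ Γ) j
  lift-sorts s g-sorts zero    = refl
  lift-sorts s g-sorts (suc j) = g-sorts j

  rename : ∀ {m m′} {Γ : Vec (Fin k) m} {Γ′ : Vec (Fin k) m′} (g : Fin m → Fin m′) →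
           (∀ j → lookup Γ′ (g j) ≡ lookup Γ j) → Formula S Γ → Formula S Γ′
  rename g g-sorts (atom b f f-sorts) = atom b (g ∘ f) (λ j → trans (g-sorts (f j)) (f-sorts j))
  rename g g-sorts (and φ ψ)          = and (rename g g-sorts φ) (rename g g-sorts ψ)
  rename g g-sorts (ex s φ)           = ex s (rename (lift 1 g) (lift-sorts s g-sorts) φ)
  rename g g-sorts (all s φ)          = all s (rename (lift 1 g) (lift-sorts s g-sorts) φ)

  ⟦rename⟧ : ∀ {m m′} {Γ : Vec (Fin k) m} {Γ′ : Vec (Fin k) m′} (g : Fin m → Fin m′)
             (g-sorts : ∀ j → lookup Γ′ (g j) ≡ lookup Γ j) (φ : Formula S Γ) v →
             ⟦ rename {Γ′ = Γ′} g g-sorts φ ⟧ v ≡ ⟦ φ ⟧ (reindex g v)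
  ⟦rename⟧ g g-sorts (atom {p = p} b f f-sorts) v = cong p (sym (reindex-∘ f g v))
  ⟦rename⟧ g g-sorts (and φ ψ) v = cong₂ _∧_ (⟦rename⟧ g g-sorts φ v) (⟦rename⟧ g g-sorts ψ v)
  ⟦rename⟧ g g-sorts (ex s φ)  v =
    cong₂ _∨_ (⟦rename⟧ (lift 1 g) _ φ (false ∷ v)) (⟦rename⟧ (lift 1 g) _ φ (true ∷ v))
  ⟦rename⟧ g g-sorts (all s φ) v =
    cong₂ _∧_ (⟦rename⟧ (lift 1 g) _ φ (false ∷ v)) (⟦rename⟧ (lift 1 g) _ φ (true ∷ v))

  Qpp-base : ∀ {n σ p} → Base S n σ p → Qpp S n σ p
  Qpp-base {p = p} b = atom b id (λ _ → refl) , cong p ∘ tabulate∘lookup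

  Qpp-append : ∀ {n σ p} s → Qpp S n σ p → Qpp S (suc n) (σ ∷ʳ s) (appendPred p)
  Qpp-append {σ = σ} {p} s (φ , φ≗p) =
    rename inject₁ (lookup-∷ʳ-inject₁ σ s) φ ,
    λ v → trans (⟦rename⟧ inject₁ _ φ v) (trans (φ≗p _) (cong p (reindex-inject₁ v)))

  Qpp-remove : ∀ {n σ p} i → Dummy p i → Qpp S (suc n) σ p → Qpp S n (removeAt σ i) (removePred p i)
  Qpp-remove {σ = σ} {p} i dummy (φ , φ≗p) =
    all (lookup σ i) φ′ ,
    λ v → trans (cong₂ _∧_ (inserted false v) (trans (inserted true v) (irrelevant v))) (∧-idem _)
    where
      g : Fin (suc _) → Fin (suc _)
      g = lookup (insertionIndices i)
      g-sorts : ∀ j → lookup (lookup σ i ∷ removeAt σ i) (g j) ≡ lookup σ j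
      g-sorts j = trans (sym (lookup-map j _ (insertionIndices i)))
        (cong (λ xs → lookup xs j)
              (trans (map-lookup-insertionIndices (lookup σ i) (removeAt σ i) i) (insertAt-removeAt σ i)))
      φ′ : Formula S (lookup σ i ∷ removeAt σ i)
      φ′ = rename g g-sorts φ
      inserted : ∀ b v → ⟦ φ′ ⟧ (b ∷ v) ≡ p (insertAt v i b)
      inserted b v = trans (⟦rename⟧ g g-sorts φ (b ∷ v))
        (trans (φ≗p _)
               (cong p (trans (reindex-lookup (insertionIndices i) (b ∷ v)) (map-lookup-insertionIndices b v i))))
      irrelevant : ∀ v → p (insertAt v i true) ≡ p (insertAt v i false)
      irrelevant v = trans (cong p (sym (insertAt-≔ v i false true))) (dummy (insertAt v i false) true)

  Qpp-perm : ∀ {n σ p} π → Qpp S n σ p → Qpp S n (permute π σ) (permPred π p)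
  Qpp-perm {σ = σ} π (φ , φ≗p) =
    rename (π ⟨$⟩ˡ_) (lookup-permute-inverse π σ) φ , λ v → trans (⟦rename⟧ _ _ φ v) (φ≗p _)

  Qpp-ident : ∀ {n s σ p} → Qpp S (suc (suc n)) (s ∷ s ∷ σ) p → Qpp S (suc n) (s ∷ σ) (identPred p)
  Qpp-ident {p = p} (φ , φ≗p) =
    rename (pinch zero) (λ { zero → refl ; (suc j) → refl }) φ ,
    λ { (x ∷ v) → trans (⟦rename⟧ (pinch zero) _ φ (x ∷ v))
                        (trans (φ≗p _) (cong (p ∘ (x ∷_)) (tabulate∘lookup (x ∷ v)))) }

  Qpp-comp : ∀ {n m s σ₁ σ₂ p₁ p₂} → Qpp S (suc n) (s ∷ σ₁) p₁ → Qpp S (suc m) (s ∷ σ₂) p₂ →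
             Qpp S (n + m) (σ₁ ++ σ₂) (compPred p₁ p₂)
  Qpp-comp {n} {m} {s} {σ₁} {σ₂} {p₁} {p₂} (φ₁ , φ₁≗p₁) (φ₂ , φ₂≗p₂) =
    ex s (and φ₁′ φ₂′) ,
    λ w → cong₂ _∨_ (cong₂ _∧_ (left false w) (right false w)) (cong₂ _∧_ (left true w) (right true w))
    where
      φ₁′ φ₂′ : Formula S (s ∷ σ₁ ++ σ₂)
      φ₁′ = rename (lift 1 (_↑ˡ m)) (lift-sorts s (lookup-++ˡ σ₁ σ₂)) φ₁
      φ₂′ = rename (lift 1 (n ↑ʳ_)) (lift-sorts s (lookup-++ʳ σ₁ σ₂)) φ₂
      left : ∀ b w → ⟦ φ₁′ ⟧ (b ∷ w) ≡ p₁ (b ∷ take n w)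
      left b w = trans (⟦rename⟧ _ _ φ₁ (b ∷ w)) (trans (φ₁≗p₁ _) (cong (p₁ ∘ (b ∷_)) (reindex-↑ˡ n w)))
      right : ∀ b w → ⟦ φ₂′ ⟧ (b ∷ w) ≡ p₂ (b ∷ drop n w)
      right b w = trans (⟦rename⟧ _ _ φ₂ (b ∷ w)) (trans (φ₂≗p₂ _) (cong (p₂ ∘ (b ∷_)) (reindex-↑ʳ n w)))

  Qpp-univ : ∀ {n s σ p} → Qpp S (suc n) (s ∷ σ) p → Qpp S n σ (univPred p)
  Qpp-univ {s = s} (φ , φ≗p) = all s φ , λ v → cong₂ _∧_ (φ≗p _) (φ≗p _)

  Qpp-conj : ∀ {n σ p q} → Qpp S n σ p → Qpp S n σ q → Qpp S n σ (conjPred p q)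
  Qpp-conj (φ , φ≗p) (ψ , ψ≗q) = and φ ψ , λ v → cong₂ _∧_ (φ≗p v) (ψ≗q v)

  EO⇒Qpp : ∀ {c n σ p} → EO c S n σ p → Qpp S n σ p
  EO⇒Qpp (base b)         = Qpp-base b
  EO⇒Qpp (append s X)     = Qpp-append s (EO⇒Qpp X)
  EO⇒Qpp (remove i d X)   = Qpp-remove i d (EO⇒Qpp X)
  EO⇒Qpp (perm π X)       = Qpp-perm π (EO⇒Qpp X)
  EO⇒Qpp (ident X)        = Qpp-ident (EO⇒Qpp X)
  EO⇒Qpp (comp _ _ X Y)   = Qpp-comp (EO⇒Qpp X) (EO⇒Qpp Y)
  EO⇒Qpp (univ X)         = Qpp-univ (EO⇒Qpp X)
  EO⇒Qpp (conj _ X Y)     = Qpp-conj (EO⇒Qpp X) (EO⇒Qpp Y)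

  EO₆⇒Qpp : ∀ {n σ p} → Has (EO₆ S) n σ p → Has (Qpp S) n σ p
  EO₆⇒Qpp (q , X , q≗p) = q , EO⇒Qpp X , q≗p

module Completeness {k} (S : Rels k) where

  Def₅ : Rels k
  Def₅ = Has (EO₅ S)

  EO₅⇒Def₅ : ∀ {n σ p} → EO₅ S n σ p → Def₅ n σ p
  EO₅⇒Def₅ X = _ , X , λ _ → refl

  Def₅-ext : ∀ {n σ p q} → Def₅ n σ p → p ≗ q → Def₅ n σ q
  Def₅-ext (r , X , r≗p) p≗q = r , X , λ v → trans (r≗p v) (p≗q v)

  Def₅-append : ∀ {n σ p} s → Def₅ n σ p → Def₅ (suc n) (σ ∷ʳ s) (appendPred p)
  Def₅-append s (q , X , q≗p) = appendPred q , append s X , q≗p ∘ init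

  Def₅-perm : ∀ {n σ p} π → Def₅ n σ p → Def₅ n (permute π σ) (permPred π p)
  Def₅-perm π (q , X , q≗p) = permPred π q , perm π X , q≗p ∘ permuteInv π

  Def₅-ident : ∀ {n s σ p} → Def₅ (suc (suc n)) (s ∷ s ∷ σ) p → Def₅ (suc n) (s ∷ σ) (identPred p)
  Def₅-ident (q , X , q≗p) = identPred q , ident X , λ { (x ∷ v) → q≗p (x ∷ x ∷ v) }

  Def₅-univ : ∀ {n s σ p} → Def₅ (suc n) (s ∷ σ) p → Def₅ n σ (univPred p)
  Def₅-univ (q , X , q≗p) = univPred q , univ X , λ v → cong₂ _∧_ (q≗p _) (q≗p _)

  Def₅-comp : ∀ {n m s σ₁ σ₂ p₁ p₂} → ¬ HeadIrrelevant p₁ → ¬ HeadIrrelevant p₂ →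
              Def₅ (suc n) (s ∷ σ₁) p₁ → Def₅ (suc m) (s ∷ σ₂) p₂ → Def₅ (n + m) (σ₁ ++ σ₂) (compPred p₁ p₂)
  Def₅-comp relevant₁ relevant₂ (q₁ , X₁ , q₁≗p₁) (q₂ , X₂ , q₂≗p₂) =
    compPred q₁ q₂ , comp (headNotDummy relevant₁ q₁≗p₁) (headNotDummy relevant₂ q₂≗p₂) X₁ X₂ ,
    λ v → cong₂ _∨_ (cong₂ _∧_ (q₁≗p₁ _) (q₂≗p₂ _)) (cong₂ _∧_ (q₁≗p₁ _) (q₂≗p₂ _))
    where
      headNotDummy : ∀ {n} {p q : Predicate (suc n)} → ¬ HeadIrrelevant p → q ≗ p → ¬ Dummy q zero
      headNotDummy relevant q≗p dummy =
        relevant λ v → trans (sym (q≗p (false ∷ v))) (trans (sym (dummy (false ∷ v) true)) (q≗p (true ∷ v)))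

  module Presentations {m} (Γ : Vec (Fin k) m) (P : Predicate m) where

    record Presentation (K : ℕ) : Set where
      constructor presentation
      field
        vars      : Vec (Fin m) K
        pred      : Predicate K
        definable : Def₅ K (map (lookup Γ) vars) pred
        presents  : ∀ v → pred (map (lookup v) vars) ≡ P v

    open Presentation

    Covers : ∀ {K} → Presentation K → Set
    Covers s = ∀ a → a ∈ vars s

    permuteP : ∀ {K} → Permutation′ K → Presentation K → Presentation K
    permuteP π s .vars       = permute π (vars s)
    permuteP π s .pred       = permPred π (pred s)
    permuteP π s .definable  =
      subst (λ σ → Def₅ _ σ (permPred π (pred s))) (sym (map-permute (lookup Γ) π (vars s)))
            (Def₅-perm π (definable s))
    permuteP π s .presents v =
      trans (cong (pred s) (trans (cong (permuteInv π) (map-permute (lookup v) π (vars s))) (permuteInv-permute π _)))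
            (presents s v)

    appendP : ∀ {K} → Fin m → Presentation K → Presentation (suc K)
    appendP a s .vars       = vars s ∷ʳ a
    appendP a s .pred       = appendPred (pred s)
    appendP a s .definable  =
      subst (λ σ → Def₅ _ σ (appendPred (pred s))) (sym (map-∷ʳ (lookup Γ) a (vars s)))
            (Def₅-append (lookup Γ a) (definable s))
    appendP a s .presents v =
      trans (cong (pred s ∘ init) (map-∷ʳ (lookup v) a (vars s))) (trans (cong (pred s) (init-∷ʳ _ _)) (presents s v))

    identP : ∀ {K} (s : Presentation (suc (suc K))) → lookup (vars s) zero ≡ lookup (vars s) (suc zero) →
             Presentation (suc K)
    identP (presentation (x ∷ .x ∷ xs) q X presents) refl =
      presentation (x ∷ xs) (identPred q) (Def₅-ident X) presents

    identP-covers : ∀ {K} (s : Presentation (suc (suc K))) same → Covers s → Covers (identP s same)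
    identP-covers (presentation (x ∷ .x ∷ xs) q X presents) refl covers a with covers a
    ... | here a≡x         = here a≡x
    ... | there (here a≡x) = here a≡x
    ... | there (there a∈) = there a∈

    mergeP : ∀ {K} (s : Presentation (suc (suc K))) → Covers s → Duplicate (vars s) →
             Σ (Presentation (suc K)) Covers
    mergeP s covers (i , j , i≢j , same) with π , π0≡i , π1≡j ← pairToFront i j i≢j =
      identP (permuteP π s) adjacent , identP-covers (permuteP π s) adjacent (∈-permute π ∘ covers)
      where
        lookup-permute : ∀ i → lookup (permute π (vars s)) i ≡ lookup (vars s) (π ⟨$⟩ʳ i)
        lookup-permute = lookup∘tabulate _
        adjacent : lookup (permute π (vars s)) zero ≡ lookup (permute π (vars s)) (suc zero)
        adjacent = trans (lookup-permute zero) (trans (cong (lookup (vars s)) π0≡i)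
                     (trans same (sym (trans (lookup-permute (suc zero)) (cong (lookup (vars s)) π1≡j)))))

    padP : ∀ {t K} → Vec (Fin m) t → Presentation K → Presentation (t + K)
    padP []       s = s
    padP (a ∷ as) s = appendP a (padP as s)

    padP-covers : ∀ {t K a} (as : Vec (Fin m) t) (s : Presentation K) → a ∈ as → a ∈ vars (padP as s)
    padP-covers (b ∷ as) s (here refl)  = ∈-∷ʳ⁺ʳ (vars (padP as s))
    padP-covers (b ∷ as) s (there a∈as) = ∈-∷ʳ⁺ˡ (padP-covers as s a∈as)

    sorted⇒Def₅ : (s : Presentation m) → vars s ≡ allFin m → Def₅ m Γ P
    sorted⇒Def₅ (presentation xs q X presents) refl =
      Def₅-ext (subst (λ σ → Def₅ m σ q) (map-lookup-allFin Γ) X)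
               (λ v → trans (cong q (sym (map-lookup-allFin v))) (presents v))

    bijective⇒Def₅ : ∀ {K} (s : Presentation K) → Covers s → Injective _≡_ _≡_ (lookup (vars s)) → Def₅ m Γ P
    bijective⇒Def₅ s covers injective with refl ← covering-injective⇒length covers injective
      with π , sorted ← sortingPermutation (vars s) covers injective = sorted⇒Def₅ (permuteP π s) sorted

    covering⇒Def₅ : ∀ {K} (s : Presentation K) → Covers s → Def₅ m Γ P
    covering⇒Def₅ s covers with duplicate? (vars s)
    covering⇒Def₅ s covers | no distinct = bijective⇒Def₅ s covers (distinct⇒injective {xs = vars s} distinct)
    covering⇒Def₅ {suc (suc K)} s covers | yes dup =
      let s′ , covers′ = mergeP s covers dup in covering⇒Def₅ s′ covers′
    covering⇒Def₅ {suc zero} s covers | yes (zero , zero , 0≢0 , _) = contradiction refl 0≢0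

  -- Add a dummy variable for every target variable, so that vars covers Fin m, then
  -- identify two variables with the same target until vars is a permutation of allFin m.
  Def₅-minor : ∀ {N m} (Γ : Vec (Fin k) m) (xs : Vec (Fin m) N) {p} →
               Def₅ N (map (lookup Γ) xs) p → Def₅ m Γ (λ v → p (map (lookup v) xs))
  Def₅-minor {m = m} Γ xs {p} X =
    covering⇒Def₅ (padP (allFin m) s₀) (λ a → padP-covers (allFin m) s₀ (∈-allFin⁺ a))
    where
      open Presentations Γ (λ v → p (map (lookup v) xs))
      s₀ : Presentation _
      s₀ = presentation xs p X (λ _ → refl)

  Def₅-diagonal : ∀ {m} {Γ : Vec (Fin k) m} {p} → Def₅ (m + m) (Γ ++ Γ) p → Def₅ m Γ (λ v → p (v ++ v))
  Def₅-diagonal {m} {Γ} {p} X =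
    Def₅-ext (Def₅-minor Γ (allFin m ++ allFin m) (subst (λ σ → Def₅ _ σ p) (sym (map-lookup-twice Γ)) X))
             (cong p ∘ map-lookup-twice)
    where
      map-lookup-twice : ∀ {A : Set} (xs : Vec A m) → map (lookup xs) (allFin m ++ allFin m) ≡ xs ++ xs
      map-lookup-twice xs =
        trans (map-++ (lookup xs) (allFin m) (allFin m)) (cong₂ _++_ (map-lookup-allFin xs) (map-lookup-allFin xs))

  Def₅-atom : ∀ {n σ p m} {Γ : Vec (Fin k) m} → Base S n σ p → (f : Fin n → Fin m) →
              (∀ j → lookup Γ (f j) ≡ lookup σ j) → Def₅ m Γ (p ∘ reindex f)
  Def₅-atom {σ = σ} {p} {Γ = Γ} b f f-sorts =
    Def₅-ext (Def₅-minor Γ (tabulate f) (subst (λ σ → Def₅ _ σ p) sorts (EO₅⇒Def₅ (base b))))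
             (λ v → cong p (sym (tabulate-∘ (lookup v) f)))
    where
      sorts : σ ≡ map (lookup Γ) (tabulate f)
      sorts = trans (sym (tabulate∘lookup σ)) (trans (tabulate-cong (sym ∘ f-sorts)) (tabulate-∘ (lookup Γ) f))

  Def₅-exists : ∀ {m s Γ p} → Def₅ (suc m) (s ∷ Γ) p → Def₅ m Γ (exPred p)
  Def₅-exists {p = p} X with headIrrelevant? p
  ... | yes irrelevant = Def₅-ext (Def₅-univ X) (univPred≗exPred {p = p} irrelevant)
  ... | no  relevant   = Def₅-ext (Def₅-diagonal (Def₅-comp relevant relevant X X))
    (λ v → trans (compPred-diagonal p p v) (cong₂ _∨_ (∧-idem (p (false ∷ v))) (∧-idem (p (true ∷ v)))))

  Def∧ : Rels k
  Def∧ = Has (EO∧ (EO₅ S))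

  Def∧-ext : ∀ {n σ p q} → Def∧ n σ p → p ≗ q → Def∧ n σ q
  Def∧-ext (r , t , r≗p) p≗q = r , t , λ v → trans (r≗p v) (p≗q v)

  Def∧-leaf : ∀ {n σ p} → Def₅ n σ p → Def∧ n σ p
  Def∧-leaf (q , X , q≗p) = q , base X , q≗p

  Def∧-conj : ∀ {n σ p q} → Def∧ n σ p → Def∧ n σ q → Def∧ n σ (conjPred p q)
  Def∧-conj (p′ , t , p′≗p) (q′ , u , q′≗q) = conjPred p′ q′ , conj t u , λ v → cong₂ _∧_ (p′≗p v) (q′≗q v)

  Def∧-pair : ∀ {m s Γ p q} → Def₅ (suc m) (s ∷ Γ) p → Def₅ (suc m) (s ∷ Γ) q → Def∧ m Γ (exPred (conjPred p q))
  Def∧-pair {p = p} {q} X Y with headIrrelevant? p | headIrrelevant? q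
  ... | yes irrelevant | _ = Def∧-ext (Def∧-conj (Def∧-leaf (Def₅-univ X)) (Def∧-leaf (Def₅-exists Y)))
                                      (exPred-conj-irrelevantˡ {p = p} {q} irrelevant)
  ... | no _ | yes irrelevant = Def∧-ext (Def∧-conj (Def∧-leaf (Def₅-exists X)) (Def∧-leaf (Def₅-univ Y)))
                                         (exPred-conj-irrelevantʳ {p = p} {q} irrelevant)
  ... | no relevant₁ | no relevant₂ =
    Def∧-leaf (Def₅-ext (Def₅-diagonal (Def₅-comp relevant₁ relevant₂ X Y)) (compPred-diagonal p q))

  -- r is the conjunction of ∃x (ρ ∧ τ) over the conjuncts ρ of p and τ of q.
  decider : ∀ {m s Γ p q} → EO∧ (EO₅ S) (suc m) (s ∷ Γ) p → EO∧ (EO₅ S) (suc m) (s ∷ Γ) q →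
            Σ (Predicate m) λ r → Def∧ m Γ r × Decides p q r
  decider (base X) (base Y) = _ , Def∧-pair (EO₅⇒Def₅ X) (EO₅⇒Def₅ Y) , decides-pair
  decider (conj t t′) u =
    let r , R , d = decider t u ; r′ , R′ , d′ = decider t′ u
    in conjPred r r′ , Def∧-conj R R′ , decides-conjˡ d d′
  decider (base X) (conj u u′) =
    let r , R , d = decider (base X) u ; r′ , R′ , d′ = decider (base X) u′
    in conjPred r r′ , Def∧-conj R R′ , decides-conjʳ d d′

  EO∧-exists : ∀ {m s Γ p} → EO∧ (EO₅ S) (suc m) (s ∷ Γ) p → Def∧ m Γ (exPred p)
  EO∧-exists (base X)   = Def∧-leaf (Def₅-exists (EO₅⇒Def₅ X))
  EO∧-exists (conj t u) =
    let r , R , d = decider t u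
    in Def∧-ext (Def∧-conj (Def∧-conj (EO∧-exists t) (EO∧-exists u)) R) (exPred-conj d)

  EO∧-univ : ∀ {m s Γ p} → EO∧ (EO₅ S) (suc m) (s ∷ Γ) p → Def∧ m Γ (univPred p)
  EO∧-univ (base X)               = Def∧-leaf (Def₅-univ (EO₅⇒Def₅ X))
  EO∧-univ (conj {p = p} {q} t u) = Def∧-ext (Def∧-conj (EO∧-univ t) (EO∧-univ u)) (univPred-conj p q)

  Def∧-exists : ∀ {m s Γ p} → Def∧ (suc m) (s ∷ Γ) p → Def∧ m Γ (exPred p)
  Def∧-exists (q , t , q≗p) = Def∧-ext (EO∧-exists t) (λ v → cong₂ _∨_ (q≗p _) (q≗p _))

  Def∧-univ : ∀ {m s Γ p} → Def∧ (suc m) (s ∷ Γ) p → Def∧ m Γ (univPred p)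
  Def∧-univ (q , t , q≗p) = Def∧-ext (EO∧-univ t) (λ v → cong₂ _∧_ (q≗p _) (q≗p _))

  Def∧-formula : ∀ {m} {Γ : Vec (Fin k) m} (φ : Formula S Γ) → Def∧ m Γ ⟦ φ ⟧
  Def∧-formula (atom b f f-sorts) = Def∧-leaf (Def₅-atom b f f-sorts)
  Def∧-formula (and φ ψ)          = Def∧-conj (Def∧-formula φ) (Def∧-formula ψ)
  Def∧-formula (ex s φ)           = Def∧-exists (Def∧-formula φ)
  Def∧-formula (all s φ)          = Def∧-univ (Def∧-formula φ)

  Qpp⇒Def∧ : ∀ {n σ p} → Has (Qpp S) n σ p → Def∧ n σ p
  Qpp⇒Def∧ (q , (φ , φ≗q) , q≗p) = Def∧-ext (Def∧-formula φ) (λ v → trans (φ≗q v) (q≗p v))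

  EO⇒EO₆ : ∀ {c n σ p} → EO c S n σ p → EO₆ S n σ p
  EO⇒EO₆ (base b)         = base b
  EO⇒EO₆ (append s X)     = append s (EO⇒EO₆ X)
  EO⇒EO₆ (remove i d X)   = remove i d (EO⇒EO₆ X)
  EO⇒EO₆ (perm π X)       = perm π (EO⇒EO₆ X)
  EO⇒EO₆ (ident X)        = ident (EO⇒EO₆ X)
  EO⇒EO₆ (comp d₁ d₂ X Y) = comp d₁ d₂ (EO⇒EO₆ X) (EO⇒EO₆ Y)
  EO⇒EO₆ (univ X)         = univ (EO⇒EO₆ X)
  EO⇒EO₆ (conj _ X Y)     = conj refl (EO⇒EO₆ X) (EO⇒EO₆ Y)

  EO∧⇒EO₆ : ∀ {n σ p} → EO∧ (EO₅ S) n σ p → EO₆ S n σ p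
  EO∧⇒EO₆ (base X)   = EO⇒EO₆ X
  EO∧⇒EO₆ (conj t u) = conj refl (EO∧⇒EO₆ t) (EO∧⇒EO₆ u)

  Def∧⇒EO₆ : ∀ {n σ p} → Def∧ n σ p → Has (EO₆ S) n σ p
  Def∧⇒EO₆ (q , t , q≗p) = q , EO∧⇒EO₆ t , q≗p

theorem4p3 : (k : ℕ) (S : Rels k) → (Qpp S ≐ EO₆ S) × (EO₆ S ≐ EO∧ (EO₅ S))
theorem4p3 k S = (λ _ _ _ → mk⇔ (Def∧⇒EO₆ ∘ Qpp⇒Def∧) EO₆⇒Qpp) , (λ _ _ _ → mk⇔ (Qpp⇒Def∧ ∘ EO₆⇒Qpp) Def∧⇒EO₆)
  where
    open Soundness S
    open Completeness S
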